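{- Let $\mathbb{B}=(B,\leq_t,\leq_k,\neg)$ be a bounded distributive bilattice, and let $\mathrm{Reg}(\mathbb{B})=\{a\in B: a=\neg a\}$. Then the tuple $\mathbb{B}^+=(\mathbb{L}_1,\mathbb{L}_2,\mathrm{n},\mathrm{p})$ with $\mathbb{L}_1=\mathbb{L}_2=(\mathrm{Reg}(\mathbb{B}),\otimes,\oplus,\bot,\top)$ (i.e. $\sqcap_1=\sqcap_2=\otimes$, $\sqcup_1=\sqcup_2=\oplus$, $1_1=1_2=\top$, $0_1=0_2=\bot$) and $\mathrm{n}=\mathrm{p}=\mathrm{Id}_{\mathrm{Reg}(\mathbb{B})}$ is a heterogeneous bilattice. Moreover, if $\mathbb{B}=(B,\leq_t,\leq_k,\neg,-)$ is a bounded commutative distributive bilattice with conflation, then $\mathbb{B}^+=((\mathrm{Reg}(\mathbb{B}),\otimes,\oplus,-,\bot,\top),(\mathrm{Reg}(\mathbb{B}),\otimes,\oplus,-,\bot,\top),\mathrm{Id}_{\mathrm{Reg}(\mathbb{B})},\mathrm{Id}_{\mathrm{Reg}(\mathbb{B})})$ (i.e. with ${\sim}_1={\sim}_2=-$) is a heterogeneous bilattice with conflation.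
   Context: A bilattice is a structure $(B,\leq_t,\leq_k,\neg)$ where $B\neq\emptyset$, $(B,\leq_t)$ and $(B,\leq_k)$ are lattices, and $\neg$ is a unary operation with: $a\leq_t b\Rightarrow \neg b\leq_t\neg a$; $a\leq_k b\Rightarrow\neg a\leq_k\neg b$; $\neg\neg a=a$. The lattice operations of $\leq_t$ are $\wedge,\vee$ with bounds $\texttt{f}$ (least) and $\texttt{t}$ (greatest); those of $\leq_k$ are $\otimes,\oplus$ with bounds $\bot$ (least) and $\top$ (greatest). It is distributive if $x\circ(y\bullet z)=(x\circ y)\bullet(x\circ z)$ for all $\circ,\bullet\in\{\wedge,\vee,\otimes,\oplus\}$. A bilattice with conflation is $(B,\leq_t,\leq_k,\neg,-)$ where $(B,\leq_t,\leq_k,\neg)$ is a bilattice and $-$ satisfies: $a\leq_t b\Rightarrow -a\leq_t -b$; $a\leq_k b\Rightarrow -b\leq_k -a$; $--a=a$; it is commutative if $\neg -x=-\neg x$ for all $x$. A De Morgan algebra is a bounded distributive lattice $(D,\sqcap,\sqcup,0,1)$ with a unary operation ${\sim}$ such that ${\sim}{\sim}a=a$ and ${\sim}(a\sqcap b)={\sim}a\sqcup{\sim}b$. A heterogeneous bilattice (HBL) is a tuple $(\mathbb{L}_1,\mathbb{L}_2,\mathrm{n},\mathrm{p})$ where $\mathbb{L}_1,\mathbb{L}_2$ are bounded distributive lattices (operations $\sqcap_i,\sqcup_i$, bounds $0_i,1_i$) and $\mathrm{n}:\mathbb{L}_1\to\mathbb{L}_2$, $\mathrm{p}:\mathbb{L}_2\to\mathbb{L}_1$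 are mutually inverse lattice isomorphisms. A heterogeneous bilattice with conflation (HCBL) is defined in the same way except that $\mathbb{L}_1,\mathbb{L}_2$ are De Morgan algebras (with negations ${\sim}_1,{\sim}_2$) and $\mathrm{n},\mathrm{p}$ are mutually inverse isomorphisms between them. -}

module Defs where

open import Level using (Level; _⊔_; suc)
open import Data.Product using (Σ; _×_; _,_; proj₁; proj₂)
open import Function using (id)
open import Relation.Binary.Core using (Rel)
open import Relation.Binary.PropositionalEquality
  using (_≡_; refl; sym; trans; cong)
open import Relation.Binary.Lattice.Structures using (IsBoundedLattice)
open import Algebra.Core using (Op₁; Op₂)
open import Algebra.Definitions using (Identity)
open import Algebra.Lattice.Structures using (IsDistributiveLattice)
open import Algebra.Lattice.Bundles using (RawLattice)
open import Algebra.Lattice.Morphism.Structures using (module LatticeMorphisms)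

record Bilattice (a ℓ : Level) : Set (suc (a ⊔ ℓ)) where
  infix  4 _≤t_ _≤k_
  infixr 7 _∧_ _⊗_
  infixr 6 _∨_ _⊕_
  field
    Carrier : Set a
    _≤t_    : Rel Carrier ℓ
    _≤k_    : Rel Carrier ℓ
    _∧_     : Op₂ Carrier
    _∨_     : Op₂ Carrier
    _⊗_     : Op₂ Carrier
    _⊕_     : Op₂ Carrier
    𝕗 𝕥     : Carrier
    ⊥ ⊤     : Carrier
    ¬_      : Op₁ Carrier
    t-isBoundedLattice : IsBoundedLattice _≡_ _≤t_ _∨_ _∧_ 𝕥 𝕗
    k-isBoundedLattice : IsBoundedLattice _≡_ _≤k_ _⊕_ _⊗_ ⊤ ⊥
    ¬-antitone-t : ∀ {a b} → a ≤t b → ¬ b ≤t ¬ a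
    ¬-monotone-k : ∀ {a b} → a ≤k b → ¬ a ≤k ¬ b
    ¬-involutive : ∀ a → ¬ (¬ a) ≡ a

data BOp : Set where
  ∧ₒ ∨ₒ ⊗ₒ ⊕ₒ : BOp

module _ {a ℓ} (𝔹 : Bilattice a ℓ) where
  open Bilattice 𝔹

  ⟦_⟧ₒ : BOp → Op₂ Carrier
  ⟦ ∧ₒ ⟧ₒ = _∧_
  ⟦ ∨ₒ ⟧ₒ = _∨_
  ⟦ ⊗ₒ ⟧ₒ = _⊗_
  ⟦ ⊕ₒ ⟧ₒ = _⊕_

  IsDistributiveBilattice : Set a
  IsDistributiveBilattice = ∀ (∘ • : BOp) (x y z : Carrier) →
    ⟦ ∘ ⟧ₒ x (⟦ • ⟧ₒ y z) ≡ ⟦ • ⟧ₒ (⟦ ∘ ⟧ₒ x y) (⟦ ∘ ⟧ₒ x z)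

  record IsConflation (-_ : Op₁ Carrier) : Set (a ⊔ ℓ) where
    field
      -‿monotone-t : ∀ {x y} → x ≤t y → - x ≤t - y
      -‿antitone-k : ∀ {x y} → x ≤k y → - y ≤k - x
      -‿involutive : ∀ x → - (- x) ≡ x

  IsCommutativeConflation : Op₁ Carrier → Set a
  IsCommutativeConflation -_ = ∀ x → ¬ (- x) ≡ - (¬ x)

  Reg : Set a
  Reg = Σ Carrier (λ x → x ≡ ¬ x)

  _≈ᴿ_ : Rel Reg a
  x ≈ᴿ y = proj₁ x ≡ proj₁ y

  private
    module K = IsBoundedLattice k-isBoundedLattice

    ¬-⊗ : ∀ x y → ¬ (x ⊗ y) ≡ ¬ x ⊗ ¬ y
    ¬-⊗ x y = K.antisym le₁ le₂
      where
      le₁ : ¬ (x ⊗ y) ≤k ¬ x ⊗ ¬ y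
      le₁ = K.∧-greatest (¬-monotone-k (K.x∧y≤x x y)) (¬-monotone-k (K.x∧y≤y x y))
      le₀ : ¬ (¬ x ⊗ ¬ y) ≤k x ⊗ y
      le₀ = K.∧-greatest
        (K.trans (¬-monotone-k (K.x∧y≤x (¬ x) (¬ y))) (K.reflexive (¬-involutive x)))
        (K.trans (¬-monotone-k (K.x∧y≤y (¬ x) (¬ y))) (K.reflexive (¬-involutive y)))
      le₂ : ¬ x ⊗ ¬ y ≤k ¬ (x ⊗ y)
      le₂ = K.trans (K.reflexive (sym (¬-involutive _))) (¬-monotone-k le₀)

    ¬-⊕ : ∀ x y → ¬ (x ⊕ y) ≡ ¬ x ⊕ ¬ y
    ¬-⊕ x y = K.antisym le₂ le₁
      where
      le₁ : ¬ x ⊕ ¬ y ≤k ¬ (x ⊕ y)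
      le₁ = K.∨-least (¬-monotone-k (K.x≤x∨y x y)) (¬-monotone-k (K.y≤x∨y x y))
      le₀ : x ⊕ y ≤k ¬ (¬ x ⊕ ¬ y)
      le₀ = K.∨-least
        (K.trans (K.reflexive (sym (¬-involutive x))) (¬-monotone-k (K.x≤x∨y (¬ x) (¬ y))))
        (K.trans (K.reflexive (sym (¬-involutive y))) (¬-monotone-k (K.y≤x∨y (¬ x) (¬ y))))
      le₂ : ¬ (x ⊕ y) ≤k ¬ x ⊕ ¬ y
      le₂ = K.trans (¬-monotone-k le₀) (K.reflexive (¬-involutive _))

    ¬⊥ : ⊥ ≡ ¬ ⊥
    ¬⊥ = K.antisym (K.minimum (¬ ⊥))
      (K.trans (¬-monotone-k (K.minimum (¬ ⊥))) (K.reflexive (¬-involutive ⊥)))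

    ¬⊤ : ⊤ ≡ ¬ ⊤
    ¬⊤ = K.antisym
      (K.trans (K.reflexive (sym (¬-involutive ⊤))) (¬-monotone-k (K.maximum (¬ ⊤))))
      (K.maximum (¬ ⊤))

  _⊗ᴿ_ : Op₂ Reg
  (x , px) ⊗ᴿ (y , py) = x ⊗ y , trans (cong₂' px py) (sym (¬-⊗ x y))
    where
    cong₂' : x ≡ ¬ x → y ≡ ¬ y → x ⊗ y ≡ ¬ x ⊗ ¬ y
    cong₂' p q rewrite sym p | sym q = refl

  _⊕ᴿ_ : Op₂ Reg
  (x , px) ⊕ᴿ (y , py) = x ⊕ y , trans (cong₂' px py) (sym (¬-⊕ x y))
    where
    cong₂' : x ≡ ¬ x → y ≡ ¬ y → x ⊕ y ≡ ¬ x ⊕ ¬ y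
    cong₂' p q rewrite sym p | sym q = refl

  ⊥ᴿ : Reg
  ⊥ᴿ = ⊥ , ¬⊥

  ⊤ᴿ : Reg
  ⊤ᴿ = ⊤ , ¬⊤

  RegRawLattice : RawLattice a a
  RegRawLattice = record
    { Carrier = Reg ; _≈_ = _≈ᴿ_ ; _∧_ = _⊗ᴿ_ ; _∨_ = _⊕ᴿ_ }

  conflᴿ : (-_ : Op₁ Carrier) → IsCommutativeConflation -_ → Op₁ Reg
  conflᴿ -_ comm (x , px) = - x , trans (cong -_ px) (sym (comm x))

module _ {c ℓ} (L : RawLattice c ℓ) where
  open RawLattice L

  record IsBoundedDistributiveLattice (𝟘 𝟙 : Carrier) : Set (c ⊔ ℓ) where
    field
      isDistributiveLattice : IsDistributiveLattice _≈_ _∨_ _∧_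
      𝟘-identity-⊔          : Identity _≈_ 𝟘 _∨_
      𝟙-identity-⊓          : Identity _≈_ 𝟙 _∧_

  record IsDeMorganAlgebra (𝟘 𝟙 : Carrier) (∼ : Op₁ Carrier) : Set (c ⊔ ℓ) where
    field
      isBoundedDistributiveLattice : IsBoundedDistributiveLattice 𝟘 𝟙
      ∼-cong       : ∀ {x y} → x ≈ y → ∼ x ≈ ∼ y
      ∼-involutive : ∀ x → ∼ (∼ x) ≈ x
      ∼-deMorgan   : ∀ x y → ∼ (x ∧ y) ≈ (∼ x ∨ ∼ y)

module _ {c₁ ℓ₁ c₂ ℓ₂} (L₁ : RawLattice c₁ ℓ₁) (L₂ : RawLattice c₂ ℓ₂) where
  private
    module L₁ = RawLattice L₁
    module L₂ = RawLattice L₂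
  open LatticeMorphisms L₁ L₂ using () renaming (IsLatticeIsomorphism to IsIso₁₂)
  open LatticeMorphisms L₂ L₁ using () renaming (IsLatticeIsomorphism to IsIso₂₁)

  record IsHBL (0₁ 1₁ : L₁.Carrier) (0₂ 1₂ : L₂.Carrier)
               (n : L₁.Carrier → L₂.Carrier) (p : L₂.Carrier → L₁.Carrier)
               : Set (c₁ ⊔ ℓ₁ ⊔ c₂ ⊔ ℓ₂) where
    field
      L₁-isBDL : IsBoundedDistributiveLattice L₁ 0₁ 1₁
      L₂-isBDL : IsBoundedDistributiveLattice L₂ 0₂ 1₂
      n-iso    : IsIso₁₂ n
      p-iso    : IsIso₂₁ p
      n∘p      : ∀ x → n (p x) L₂.≈ x
      p∘n      : ∀ x → p (n x) L₁.≈ x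

  record IsHCBL (0₁ 1₁ : L₁.Carrier) (∼₁ : Op₁ L₁.Carrier)
                (0₂ 1₂ : L₂.Carrier) (∼₂ : Op₁ L₂.Carrier)
                (n : L₁.Carrier → L₂.Carrier) (p : L₂.Carrier → L₁.Carrier)
                : Set (c₁ ⊔ ℓ₁ ⊔ c₂ ⊔ ℓ₂) where
    field
      L₁-isDMA : IsDeMorganAlgebra L₁ 0₁ 1₁ ∼₁
      L₂-isDMA : IsDeMorganAlgebra L₂ 0₂ 1₂ ∼₂
      n-iso    : IsIso₁₂ n
      p-iso    : IsIso₂₁ p
      n-∼      : ∀ x → n (∼₁ x) L₂.≈ ∼₂ (n x)
      p-∼      : ∀ x → p (∼₂ x) L₁.≈ ∼₁ (p x)
      n∘p      : ∀ x → n (p x) L₂.≈ x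
      p∘n      : ∀ x → p (n x) L₁.≈ x

-- Since ¬ is a knowledge automorphism, Reg(B) is closed under ⊗, ⊕, ⊥, ⊤, so the
-- embedding Reg(B) → (B, ⊗, ⊕) is a lattice monomorphism and Reg(B) inherits the
-- bounded distributive lattice structure of the knowledge lattice (only ⊗ over ⊕
-- is needed). A commutative conflation preserves Reg(B), and as an antitone
-- involution of ≤k it turns ⊗ into ⊕, giving a De Morgan algebra. With n = p = id
-- the remaining heterogeneous conditions are reflexivity.

module Submission where

open import Defs
open import Data.Product using (_×_; _,_; proj₁)
open import Function using (id)
open import Algebra.Core using (Op₁)
open import Algebra.Definitions using (_DistributesOverˡ_)
open import Algebra.Lattice.Bundles using (RawLattice)
open import Algebra.Lattice using (isDistributiveLatticeʳʲᵐ)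
  renaming (IsDistributiveLattice to IsAlgDistributiveLattice)
open import Algebra.Lattice.Morphism.Structures using (module LatticeMorphisms)
import Algebra.Lattice.Morphism.Construct.Identity as Identity
import Algebra.Lattice.Morphism.LatticeMonomorphism as LatticeMonomorphism
open import Relation.Binary.Definitions using (Reflexive)
open import Relation.Binary.PropositionalEquality using (_≡_; refl; cong)
open import Relation.Binary.Lattice.Bundles
  using (Lattice; BoundedLattice; DistributiveLattice)
import Relation.Binary.Lattice.Properties.Lattice as LatticeProperties
import Relation.Binary.Lattice.Properties.DistributiveLattice as DistributiveLatticeProperties
import Relation.Binary.Lattice.Properties.BoundedJoinSemilattice as BoundedJoinSemilatticeProperties
import Relation.Binary.Lattice.Properties.BoundedMeetSemilattice as BoundedMeetSemilatticeProperties
import Relation.Binary.Reasoning.PartialOrder as ≤-Reasoning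

module _ {c ℓ₁ ℓ₂} (L : Lattice c ℓ₁ ℓ₂) where
  open Lattice L

  antitone∧involutive⇒deMorgan : (f : Carrier → Carrier) →
    (∀ {x y} → x ≤ y → f y ≤ f x) → (∀ x → f (f x) ≈ x) →
    ∀ x y → f (x ∧ y) ≈ f x ∨ f y
  antitone∧involutive⇒deMorgan f antitone involutive x y =
    antisym f[x∧y]≤fx∨fy (∨-least (antitone (x∧y≤x x y)) (antitone (x∧y≤y x y)))
    where
    open ≤-Reasoning poset
    f[fx∨fy]≤x∧y : f (f x ∨ f y) ≤ x ∧ y
    f[fx∨fy]≤x∧y = ∧-greatest
      (begin f (f x ∨ f y) ≤⟨ antitone (x≤x∨y (f x) (f y)) ⟩ f (f x) ≈⟨ involutive x ⟩ x ∎)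
      (begin f (f x ∨ f y) ≤⟨ antitone (y≤x∨y (f x) (f y)) ⟩ f (f y) ≈⟨ involutive y ⟩ y ∎)
    f[x∧y]≤fx∨fy : f (x ∧ y) ≤ f x ∨ f y
    f[x∧y]≤fx∨fy = begin
      f (x ∧ y)               ≤⟨ antitone f[fx∨fy]≤x∧y ⟩
      f (f (f x ∨ f y))       ≈⟨ involutive (f x ∨ f y) ⟩
      f x ∨ f y               ∎

module _ {c ℓ} (L : RawLattice c ℓ) where
  open RawLattice L

  id-isHBL : ∀ {𝟘 𝟙} → IsBoundedDistributiveLattice L 𝟘 𝟙 → IsHBL L L 𝟘 𝟙 𝟘 𝟙 id id
  id-isHBL isBDL = record
    { L₁-isBDL = isBDL
    ; L₂-isBDL = isBDL
    ; n-iso    = Identity.isLatticeIsomorphism L ≈-refl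
    ; p-iso    = Identity.isLatticeIsomorphism L ≈-refl
    ; n∘p      = λ _ → ≈-refl
    ; p∘n      = λ _ → ≈-refl
    }
    where
    ≈-refl : Reflexive _≈_
    ≈-refl = IsAlgDistributiveLattice.refl
      (IsBoundedDistributiveLattice.isDistributiveLattice isBDL)

  id-isHCBL : ∀ {𝟘 𝟙 ∼} → IsDeMorganAlgebra L 𝟘 𝟙 ∼ → IsHCBL L L 𝟘 𝟙 ∼ 𝟘 𝟙 ∼ id id
  id-isHCBL {∼ = ∼} isDMA = record
    { L₁-isDMA = isDMA
    ; L₂-isDMA = isDMA
    ; n-iso    = n-iso
    ; p-iso    = p-iso
    ; n-∼      = λ x → n∘p (∼ x)
    ; p-∼      = λ x → p∘n (∼ x)
    ; n∘p      = n∘p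
    ; p∘n      = p∘n
    }
    where
    open IsHBL (id-isHBL (IsDeMorganAlgebra.isBoundedDistributiveLattice isDMA))

module _ {a ℓ} (𝔹 : Bilattice a ℓ) where
  open Bilattice 𝔹

  knowledgeBoundedLattice : BoundedLattice a a ℓ
  knowledgeBoundedLattice = record { isBoundedLattice = k-isBoundedLattice }

  open BoundedLattice knowledgeBoundedLattice using (lattice; isLattice)

  knowledgeRawLattice : RawLattice a a
  knowledgeRawLattice = record
    { Carrier = Carrier ; _≈_ = _≡_ ; _∧_ = _⊗_ ; _∨_ = _⊕_ }

  proj₁-isLatticeMonomorphism :
    LatticeMorphisms.IsLatticeMonomorphism (RegRawLattice 𝔹) knowledgeRawLattice proj₁
  proj₁-isLatticeMonomorphism = record
    { isLatticeHomomorphism = record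
      { isRelHomomorphism = record { cong = id }
      ; ∧-homo            = λ _ _ → refl
      ; ∨-homo            = λ _ _ → refl
      }
    ; injective = id
    }

  module _ (⊗-distribˡ-⊕ : _DistributesOverˡ_ _≡_ _⊗_ _⊕_) where

    knowledgeDistributiveLattice : DistributiveLattice a a ℓ
    knowledgeDistributiveLattice = record
      { isDistributiveLattice = record
        { isLattice = isLattice ; ∧-distribˡ-∨ = ⊗-distribˡ-⊕ } }

    ⊕-⊗-isDistributiveLattice : IsAlgDistributiveLattice _≡_ _⊕_ _⊗_
    ⊕-⊗-isDistributiveLattice = isDistributiveLatticeʳʲᵐ (record
      { isLattice    = LatticeProperties.isAlgLattice lattice
      ; ∨-distribʳ-∧ = DistributiveLatticeProperties.∨-distribʳ-∧
                         knowledgeDistributiveLattice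
      })

    Reg-isBoundedDistributiveLattice :
      IsBoundedDistributiveLattice (RegRawLattice 𝔹) (⊥ᴿ 𝔹) (⊤ᴿ 𝔹)
    Reg-isBoundedDistributiveLattice = record
      { isDistributiveLattice =
          LatticeMonomorphism.isDistributiveLattice
            proj₁-isLatticeMonomorphism ⊕-⊗-isDistributiveLattice
      ; 𝟘-identity-⊔ = (λ x → ⊥-identityˡ (proj₁ x)) , (λ x → ⊥-identityʳ (proj₁ x))
      ; 𝟙-identity-⊓ = (λ x → ⊤-identityˡ (proj₁ x)) , (λ x → ⊤-identityʳ (proj₁ x))
      }
      where
      open BoundedLattice knowledgeBoundedLattice
        using (boundedJoinSemilattice; boundedMeetSemilattice)
      open BoundedJoinSemilatticeProperties boundedJoinSemilattice
        using () renaming (identityˡ to ⊥-identityˡ; identityʳ to ⊥-identityʳ)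
      open BoundedMeetSemilatticeProperties boundedMeetSemilattice
        using () renaming (identityˡ to ⊤-identityˡ; identityʳ to ⊤-identityʳ)

    Reg-isDeMorganAlgebra : ∀ { -_ } → IsConflation 𝔹 -_ →
      (comm : IsCommutativeConflation 𝔹 -_) →
      IsDeMorganAlgebra (RegRawLattice 𝔹) (⊥ᴿ 𝔹) (⊤ᴿ 𝔹) (conflᴿ 𝔹 -_ comm)
    Reg-isDeMorganAlgebra { -_ } isConflation comm = record
      { isBoundedDistributiveLattice = Reg-isBoundedDistributiveLattice
      ; ∼-cong       = cong -_
      ; ∼-involutive = λ x → -‿involutive (proj₁ x)
      ; ∼-deMorgan   = λ x y →
          antitone∧involutive⇒deMorgan lattice -_ -‿antitone-k -‿involutive
            (proj₁ x) (proj₁ y)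
      }
      where open IsConflation isConflation

proposition1 : ∀ {a ℓ} →
    ((𝔹 : Bilattice a ℓ) → IsDistributiveBilattice 𝔹 →
      IsHBL (RegRawLattice 𝔹) (RegRawLattice 𝔹)
        (⊥ᴿ 𝔹) (⊤ᴿ 𝔹) (⊥ᴿ 𝔹) (⊤ᴿ 𝔹) id id)
    ×
    ((𝔹 : Bilattice a ℓ) (- : Op₁ (Bilattice.Carrier 𝔹)) →
      IsDistributiveBilattice 𝔹 → IsConflation 𝔹 - →
      (comm : IsCommutativeConflation 𝔹 -) →
      IsHCBL (RegRawLattice 𝔹) (RegRawLattice 𝔹)
        (⊥ᴿ 𝔹) (⊤ᴿ 𝔹) (conflᴿ 𝔹 - comm) (⊥ᴿ 𝔹) (⊤ᴿ 𝔹) (conflᴿ 𝔹 - comm) id id)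
proposition1 =
  (λ 𝔹 dist → id-isHBL (RegRawLattice 𝔹)
    (Reg-isBoundedDistributiveLattice 𝔹 (dist ⊗ₒ ⊕ₒ)))
  ,
  (λ 𝔹 - dist isConflation comm → id-isHCBL (RegRawLattice 𝔹)
    (Reg-isDeMorganAlgebra 𝔹 (dist ⊗ₒ ⊕ₒ) isConflation comm))
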